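{- Let $G$ be a finite simple graph of the form $G=B\cup G_1\cup\cdots\cup G_m$, where $m\ge 2$, $B,G_1,\dots,G_m$ are subgraphs of $G$, the graphs $G_1,\dots,G_m$ are pairwise vertex-disjoint, and each $G_i$ shares exactly one vertex $x_i$ with $B$. Let $p$ be an integer such that $\mathrm{pw}(G_i;x_i)\le p$ for all $i\in\{2,\dots,m\}$. Then for every $x\in V(B)$, \[\mathrm{pw}(G;x)\le \max\{\mathrm{pw}(B;x_1)+p+1,\ \mathrm{pw}(G_1;x_1)\}.\]
   Context: A path-decomposition of a graph $H$ is a sequence $(X_0,\dots,X_s)$ of subsets of $V(H)$ such that for every vertex $v$ the indices $i$ with $v\in X_i$ form a non-empty interval, and every edge has both ends in some $X_i$; its width is $\max_i|X_i|-1$. For a vertex $u$ of $H$, $\mathrm{pw}(H;u)$ is the minimum width of a path-decomposition $(X_0,\dots,X_s)$ of $H$ with $u\in X_0$. -}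

module Defs where

open import Data.Nat using (ℕ; suc; _≤_; _+_; _⊔_)
open import Data.Fin using (Fin; toℕ)
open import Data.Fin.Subset using (Subset; _∈_; _∉_; _⊆_; ∣_∣)
open import Data.Bool using (Bool; true; false)
open import Data.Product using (Σ; ∃; _×_)
open import Data.Sum using (_⊎_)
open import Relation.Binary.PropositionalEquality using (_≡_)

-- A finite simple graph whose vertex set is a subset of Fin n
-- (vertices are labelled by Fin n; the ambient label set is irrelevant).
record SGraph (n : ℕ) : Set where
  field
    V      : Subset n
    E      : Fin n → Fin n → Bool
    E-sym  : ∀ u v → E u v ≡ E v u
    E-irr  : ∀ u → E u u ≡ false
    E-V    : ∀ u v → E u v ≡ true → (u ∈ V) × (v ∈ V)
open SGraph public

_≤G_ : ∀ {n} → SGraph n → SGraph n → Set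
H ≤G G = (V H ⊆ V G) × (∀ u v → E H u v ≡ true → E G u v ≡ true)

record PathDecomposition {n : ℕ} (H : SGraph n) : Set where
  field
    s        : ℕ
    X        : Fin (suc s) → Subset n
    bags-V   : ∀ i → X i ⊆ V H
    covers   : ∀ v → v ∈ V H → ∃ λ i → v ∈ X i
    interval : ∀ v (i j k : Fin (suc s)) → toℕ i ≤ toℕ j → toℕ j ≤ toℕ k →
               v ∈ X i → v ∈ X k → v ∈ X j
    edges    : ∀ u v → E H u v ≡ true → ∃ λ i → (u ∈ X i) × (v ∈ X i)
open PathDecomposition public

WidthAtMost : ∀ {n} {H : SGraph n} → PathDecomposition H → ℕ → Set
WidthAtMost D k = ∀ i → ∣ X D i ∣ ≤ suc k

PwAtMost : ∀ {n} → SGraph n → Fin n → ℕ → Set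
PwAtMost H u k = Σ (PathDecomposition H) λ D →
  (u ∈ X D Fin.zero) × WidthAtMost D k

-- Reverse a path-decomposition of B that has xs zero in its first bag and add x to every bag:
-- now x is in the first bag and xs zero in the last, at width a + 1. Append the decomposition of
-- Gs zero, and for i ≠ zero insert the bags Zᵢ of the decomposition of Gs i right after the last
-- bag Y containing xs i, as (Y - xs i) ∪ Zᵢ, of size at most (a + 1) + (p + 1). Rather than
-- splicing sequences of bags, every vertex is given an interval of positions on ℕ, which makes
-- the interval property automatic; the bags are read off the intervals.
module Submission where

open import Defs
open import Data.Bool using (Bool; true; false; if_then_else_)
open import Data.Fin using (Fin; zero; suc; toℕ; fromℕ; fromℕ<; opposite)
open import Data.Fin.Properties
  using (toℕ<n; toℕ-fromℕ; toℕ-fromℕ<; fromℕ<-toℕ; toℕ-injective; opposite-prop; opposite-involutive; any?)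
  renaming (_≟_ to _≟ᶠ_)
open import Data.Fin.Subset using (Subset; _∈_; _∉_; _⊆_; ∣_∣; ⊥; _∪_; ⁅_⁆; _-_; inside; outside)
open import Data.Fin.Subset.Properties
  using ( _∈?_; ∉⊥; x∈p∪q⁺; x∈p∪q⁻; x∈⁅x⁆; x∈⁅y⁆⇒x≡y; ∣⁅x⁆∣≡1; ∣⊥∣≡0
        ; p⊆q⇒∣p∣≤∣q∣; x∈p⇒∣p-x∣<∣p∣; x∈p∧x≢y⇒x∈p-y)
open import Data.Nat
  using (ℕ; zero; suc; z<s; _+_; _*_; _∸_; _⊔_; _≤_; _<_; z≤n; s≤s; s≤s⁻¹; _≤?_; _<?_; NonZero)
open import Data.Nat.Properties
open import Data.Nat.DivMod using (_/_; m≡m%n+[m/n]*n; m%n<n; m/n*n≤m)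
open import Data.Product using (∃; _×_; _,_; proj₁; proj₂)
open import Data.Sum using (_⊎_; inj₁; inj₂; [_,_]′)
open import Data.Vec using (_∷_; []; lookup; tabulate)
open import Data.Vec.Properties using ([]=⇒lookup; lookup⇒[]=; lookup∘tabulate)
open import Relation.Nullary using (Dec; yes; no; does; ¬_; contradiction)
open import Relation.Nullary.Decidable using (_×-dec_; map′)
open import Relation.Binary.PropositionalEquality

∣p∪q∣≤∣p∣+∣q∣ : ∀ {n} (p q : Subset n) → ∣ p ∪ q ∣ ≤ ∣ p ∣ + ∣ q ∣
∣p∪q∣≤∣p∣+∣q∣ []            []            = z≤n
∣p∪q∣≤∣p∣+∣q∣ (inside ∷ p)  (inside ∷ q)  =
  s≤s (≤-trans (m≤n⇒m≤1+n (∣p∪q∣≤∣p∣+∣q∣ p q)) (≤-reflexive (sym (+-suc _ _))))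
∣p∪q∣≤∣p∣+∣q∣ (inside ∷ p)  (outside ∷ q) = s≤s (∣p∪q∣≤∣p∣+∣q∣ p q)
∣p∪q∣≤∣p∣+∣q∣ (outside ∷ p) (inside ∷ q)  =
  ≤-trans (s≤s (∣p∪q∣≤∣p∣+∣q∣ p q)) (≤-reflexive (sym (+-suc _ _)))
∣p∪q∣≤∣p∣+∣q∣ (outside ∷ p) (outside ∷ q) = ∣p∪q∣≤∣p∣+∣q∣ p q

-- The least / greatest c < m with P c; junk values when there is none.

least : (ℕ → Bool) → ℕ → ℕ
least P zero    = zero
least P (suc m) = if P 0 then 0 else suc (least (λ c → P (suc c)) m)

least-≤ : ∀ (P : ℕ → Bool) m {c} → P c ≡ true → least P m ≤ c
least-≤ P zero    _  = z≤n
least-≤ P (suc m) {c} Pc with P 0 in P0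
... | true  = z≤n
least-≤ P (suc m) {zero}  Pc | false = contradiction (trans (sym P0) Pc) λ ()
least-≤ P (suc m) {suc c} Pc | false = s≤s (least-≤ (λ c → P (suc c)) m Pc)

least-holds : ∀ (P : ℕ → Bool) m {c} → P c ≡ true → c < m → P (least P m) ≡ true
least-holds P (suc m) {c} Pc c<m with P 0 in P0
... | true = P0
least-holds P (suc m) {zero}  Pc _         | false = contradiction (trans (sym P0) Pc) λ ()
least-holds P (suc m) {suc c} Pc (s≤s c<m) | false = least-holds (λ c → P (suc c)) m Pc c<m

greatest : (ℕ → Bool) → ℕ → ℕ
greatest P zero    = zero
greatest P (suc m) = if P m then m else greatest P m

greatest-≥ : ∀ (P : ℕ → Bool) m {c} → P c ≡ true → c < m → c ≤ greatest P m
greatest-≥ P (suc m) {c} Pc c<m with P m in Pm | m≤n⇒m<n∨m≡n (s≤s⁻¹ c<m)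
... | true  | _          = s≤s⁻¹ c<m
... | false | inj₁ c<m′  = greatest-≥ P m Pc c<m′
... | false | inj₂ refl  = contradiction (trans (sym Pm) Pc) λ ()

greatest-holds : ∀ (P : ℕ → Bool) m {c} → P c ≡ true → c < m → P (greatest P m) ≡ true
greatest-holds P (suc m) {c} Pc c<m with P m in Pm | m≤n⇒m<n∨m≡n (s≤s⁻¹ c<m)
... | true  | _         = Pm
... | false | inj₁ c<m′ = greatest-holds P m Pc c<m′
... | false | inj₂ refl = contradiction (trans (sym Pm) Pc) λ ()

greatest-< : ∀ (P : ℕ → Bool) m → greatest P (suc m) ≤ m
greatest-< P m with P m
... | true  = ≤-refl
greatest-< P zero    | false = z≤n
greatest-< P (suc m) | false = m≤n⇒m≤1+n (greatest-< P m)

maxᶠ : ∀ m → (Fin m → ℕ) → ℕ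
maxᶠ zero    f = 0
maxᶠ (suc m) f = f zero ⊔ maxᶠ m (λ i → f (suc i))

≤maxᶠ : ∀ m f (i : Fin m) → f i ≤ maxᶠ m f
≤maxᶠ (suc m) f zero    = m≤m⊔n _ _
≤maxᶠ (suc m) f (suc i) = ≤-trans (≤maxᶠ m (λ i → f (suc i)) i) (m≤n⊔m _ _)

record Block (m j c : ℕ) : Set where
  constructor block
  field
    lower : j * m ≤ c
    upper : c < suc j * m

Block-lower : ∀ {m q j c} → q * m ≤ c → Block m j c → q ≤ j
Block-lower {m} {q} {j} qm≤c (block _ c<) = s≤s⁻¹ (*-cancelʳ-< m q (suc j) (≤-<-trans qm≤c c<))

Block-upper : ∀ {m q j c} → c < suc q * m → Block m j c → j ≤ q
Block-upper {m} {q} {j} c< (block jm≤c _) = s≤s⁻¹ (*-cancelʳ-< m j (suc q) (≤-<-trans jm≤c c<))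

Block-unique : ∀ {m j j′ c} → Block m j c → Block m j′ c → j ≡ j′
Block-unique b b′ = ≤-antisym (Block-lower (Block.lower b) b′) (Block-lower (Block.lower b′) b)

Block-+ : ∀ {m j r} → r < m → Block m j (r + j * m)
Block-+ {m} {j} {r} r<m = block (m≤n+m (j * m) r) (+-monoˡ-< (j * m) r<m)

blockOf : ∀ m .{{_ : NonZero m}} c → Block m (c / m) c
blockOf m c = block (m/n*n≤m c m)
  (subst (_< suc (c / m) * m) (sym (m≡m%n+[m/n]*n c m)) (+-monoˡ-< ((c / m) * m) (m%n<n c m)))

opposite-anti : ∀ {m} {i j : Fin m} → toℕ i ≤ toℕ j → toℕ (opposite j) ≤ toℕ (opposite i)
opposite-anti {m} {i} {j} i≤j = begin
  toℕ (opposite j)  ≡⟨ opposite-prop j ⟩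
  m ∸ suc (toℕ j)   ≤⟨ ∸-monoʳ-≤ m (s≤s i≤j) ⟩
  m ∸ suc (toℕ i)   ≡⟨ opposite-prop i ⟨
  toℕ (opposite i)  ∎
  where open ≤-Reasoning

module _ {n} {H : SGraph n} where

  reverse : PathDecomposition H → PathDecomposition H
  reverse D = record
    { s        = s D
    ; X        = λ i → X D (opposite i)
    ; bags-V   = λ i → bags-V D (opposite i)
    ; covers   = λ v v∈H → let (i , v∈Xi) = covers D v v∈H in opposite i , ∈X-opposite² v∈Xi
    ; interval = λ v i j k i≤j j≤k v∈Xi v∈Xk →
                   interval D v (opposite k) (opposite j) (opposite i) (opposite-anti j≤k) (opposite-anti i≤j) v∈Xk v∈Xi
    ; edges    = λ u v e → let (i , u∈Xi , v∈Xi) = edges D u v e in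
                   opposite i , ∈X-opposite² u∈Xi , ∈X-opposite² v∈Xi
    }
    where
    ∈X-opposite² : ∀ {v i} → v ∈ X D i → v ∈ X D (opposite (opposite i))
    ∈X-opposite² {v} {i} = subst (λ j → v ∈ X D j) (sym (opposite-involutive i))

  reverse-width : ∀ (D : PathDecomposition H) {w} → WidthAtMost D w → WidthAtMost (reverse D) w
  reverse-width D width i = width (opposite i)

  reverse-∈last : ∀ (D : PathDecomposition H) {v} → v ∈ X D zero → v ∈ X (reverse D) (fromℕ (s D))
  reverse-∈last D {v} = subst (λ j → v ∈ X D j) (sym (opposite-involutive zero))

  addToBags : (u : Fin n) → u ∈ V H → PathDecomposition H → PathDecomposition H
  addToBags u u∈H D = record
    { s        = s D
    ; X        = λ i → ⁅ u ⁆ ∪ X D i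
    ; bags-V   = λ i m → [ (λ v∈u → subst (_∈ V H) (sym (x∈⁅y⁆⇒x≡y u v∈u)) u∈H) , bags-V D i ]′
                           (x∈p∪q⁻ _ _ m)
    ; covers   = λ v v∈H → let (i , v∈Xi) = covers D v v∈H in i , x∈p∪q⁺ (inj₂ v∈Xi)
    ; interval = λ v i j k i≤j j≤k mi mk → interval′ v i j k i≤j j≤k (x∈p∪q⁻ _ _ mi) (x∈p∪q⁻ _ _ mk)
    ; edges    = λ v w e → let (i , v∈Xi , w∈Xi) = edges D v w e in
                   i , x∈p∪q⁺ (inj₂ v∈Xi) , x∈p∪q⁺ (inj₂ w∈Xi)
    }
    where
    interval′ : ∀ v i j k → toℕ i ≤ toℕ j → toℕ j ≤ toℕ k →
                v ∈ ⁅ u ⁆ ⊎ v ∈ X D i → v ∈ ⁅ u ⁆ ⊎ v ∈ X D k → v ∈ ⁅ u ⁆ ∪ X D j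
    interval′ v i j k _   _   (inj₁ v∈u)  _           = x∈p∪q⁺ (inj₁ v∈u)
    interval′ v i j k _   _   (inj₂ _)    (inj₁ v∈u)  = x∈p∪q⁺ (inj₁ v∈u)
    interval′ v i j k i≤j j≤k (inj₂ v∈Xi) (inj₂ v∈Xk) = x∈p∪q⁺ (inj₂ (interval D v i j k i≤j j≤k v∈Xi v∈Xk))

  addToBags-∈ : ∀ {u} (u∈H : u ∈ V H) (D : PathDecomposition H) i → u ∈ X (addToBags u u∈H D) i
  addToBags-∈ {u} _ _ _ = x∈p∪q⁺ (inj₁ (x∈⁅x⁆ u))

  addToBags-⊇ : ∀ {u} (u∈H : u ∈ V H) (D : PathDecomposition H) {v} i → v ∈ X D i → v ∈ X (addToBags u u∈H D) i
  addToBags-⊇ _ _ _ v∈Xi = x∈p∪q⁺ (inj₂ v∈Xi)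

  addToBags-width : ∀ {u} (u∈H : u ∈ V H) (D : PathDecomposition H) {w} →
                    WidthAtMost D w → WidthAtMost (addToBags u u∈H D) (suc w)
  addToBags-width {u} _ D {w} width i = begin
    ∣ ⁅ u ⁆ ∪ X D i ∣       ≤⟨ ∣p∪q∣≤∣p∣+∣q∣ ⁅ u ⁆ (X D i) ⟩
    ∣ ⁅ u ⁆ ∣ + ∣ X D i ∣   ≡⟨ cong (_+ ∣ X D i ∣) (∣⁅x⁆∣≡1 u) ⟩
    suc ∣ X D i ∣           ≤⟨ s≤s (width i) ⟩
    suc (suc w)             ∎
    where open ≤-Reasoning

-- Bags indexed by ℕ, empty past the end.
module Occurrences {n} {H : SGraph n} (D : PathDecomposition H) where

  private
    bagOf : ∀ {c} → Dec (c < suc (s D)) → Subset n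
    bagOf (yes c≤s) = X D (fromℕ< c≤s)
    bagOf (no _)    = ⊥

    bagOf⁻ : ∀ {c v} (d : Dec (c < suc (s D))) → v ∈ bagOf d → ∃ λ i → toℕ i ≡ c × v ∈ X D i
    bagOf⁻ (yes c≤s) v∈X = fromℕ< c≤s , toℕ-fromℕ< c≤s , v∈X
    bagOf⁻ (no _)    v∈⊥ = contradiction v∈⊥ ∉⊥

    bagOf⁺ : ∀ {v} i (d : Dec (toℕ i < suc (s D))) → v ∈ X D i → v ∈ bagOf d
    bagOf⁺ {v} i (yes i≤s) = subst (λ j → v ∈ X D j) (sym (fromℕ<-toℕ i i≤s))
    bagOf⁺     i (no i≰s)  = contradiction (toℕ<n i) i≰s

    bagOf-size : ∀ {c w} → WidthAtMost D w → (d : Dec (c < suc (s D))) → ∣ bagOf d ∣ ≤ suc w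
    bagOf-size width (yes _) = width _
    bagOf-size _     (no _)  = ≤-trans (≤-reflexive (∣⊥∣≡0 n)) z≤n

  bagAt : ℕ → Subset n
  bagAt c = bagOf (c <? suc (s D))

  -- a wrapper, so that c can be inferred from a membership proof
  record InBag (v : Fin n) (c : ℕ) : Set where
    constructor inBag
    field ∈bagAt : v ∈ bagAt c
  open InBag public

  InBag⇒∈X : ∀ {v c} → InBag v c → ∃ λ i → toℕ i ≡ c × v ∈ X D i
  InBag⇒∈X {c = c} (inBag v∈c) = bagOf⁻ (c <? suc (s D)) v∈c

  ∈X⇒InBag : ∀ {v} i → v ∈ X D i → InBag v (toℕ i)
  ∈X⇒InBag i v∈Xi = inBag (bagOf⁺ i (toℕ i <? suc (s D)) v∈Xi)

  InBag⇒∈V : ∀ {v c} → InBag v c → v ∈ V H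
  InBag⇒∈V v∈c = let (i , _ , v∈Xi) = InBag⇒∈X v∈c in bags-V D i v∈Xi

  InBag⇒≤s : ∀ {v c} → InBag v c → c ≤ s D
  InBag⇒≤s v∈c with InBag⇒∈X v∈c
  ... | i , refl , _ = s≤s⁻¹ (toℕ<n i)

  ∣bagAt∣≤ : ∀ {w} → WidthAtMost D w → ∀ c → ∣ bagAt c ∣ ≤ suc w
  ∣bagAt∣≤ width c = bagOf-size width (c <? suc (s D))

  InBag-interval : ∀ {v c₁ c₂ c₃} → InBag v c₁ → InBag v c₃ → c₁ ≤ c₂ → c₂ ≤ c₃ → InBag v c₂
  InBag-interval {v} {c₂ = c₂} v∈c₁ v∈c₃ c₁≤c₂ c₂≤c₃ with InBag⇒∈X v∈c₁ | InBag⇒∈X v∈c₃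
  ... | i , refl , v∈Xi | k , refl , v∈Xk =
    subst (InBag v) (toℕ-fromℕ< c₂<)
      (∈X⇒InBag j (interval D v i j k (subst (toℕ i ≤_) (sym j≡c₂) c₁≤c₂) (subst (_≤ toℕ k) (sym j≡c₂) c₂≤c₃)
                                       v∈Xi v∈Xk))
    where
    c₂< : c₂ < suc (s D)
    c₂< = ≤-<-trans c₂≤c₃ (toℕ<n k)
    j = fromℕ< c₂<
    j≡c₂ : toℕ j ≡ c₂
    j≡c₂ = toℕ-fromℕ< c₂<

  occurs : ∀ {v} → v ∈ V H → ∃ (InBag v)
  occurs {v} v∈H = let (i , v∈Xi) = covers D v v∈H in toℕ i , ∈X⇒InBag i v∈Xi

  private
    member : Fin n → ℕ → Bool
    member v c = lookup (bagAt c) v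

  first last : Fin n → ℕ
  first v = least (member v) (suc (s D))
  last v  = greatest (member v) (suc (s D))

  first≤ : ∀ {v c} → InBag v c → first v ≤ c
  first≤ {v} (inBag v∈c) = least-≤ (member v) (suc (s D)) ([]=⇒lookup v∈c)

  ≤last : ∀ {v c} → InBag v c → c ≤ last v
  ≤last {v} v∈c = greatest-≥ (member v) (suc (s D)) ([]=⇒lookup (∈bagAt v∈c)) (s≤s (InBag⇒≤s v∈c))

  last≤s : ∀ v → last v ≤ s D
  last≤s v = greatest-< (member v) (s D)

  first≤last : ∀ {v} → v ∈ V H → first v ≤ last v
  first≤last v∈H = let (_ , v∈c) = occurs v∈H in ≤-trans (first≤ v∈c) (≤last v∈c)

  between⇒InBag : ∀ {v c} → v ∈ V H → first v ≤ c → c ≤ last v → InBag v c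
  between⇒InBag {v} v∈H = InBag-interval (inBag (lookup⇒[]= v _ first-holds)) (inBag (lookup⇒[]= v _ last-holds))
    where
    c₀ = proj₁ (occurs v∈H)
    v∈c₀ = proj₂ (occurs v∈H)
    first-holds : member v (first v) ≡ true
    first-holds = least-holds (member v) (suc (s D)) {c₀} ([]=⇒lookup (∈bagAt v∈c₀)) (s≤s (InBag⇒≤s v∈c₀))
    last-holds : member v (last v) ≡ true
    last-holds = greatest-holds (member v) (suc (s D)) {c₀} ([]=⇒lookup (∈bagAt v∈c₀)) (s≤s (InBag⇒≤s v∈c₀))

  first≡0 : ∀ {v} → v ∈ X D zero → first v ≡ 0
  first≡0 v∈X₀ = n≤0⇒n≡0 (first≤ (∈X⇒InBag zero v∈X₀))

  s≤last : ∀ {v} → v ∈ X D (fromℕ (s D)) → s D ≤ last v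
  s≤last {v} v∈Xs = subst (_≤ last v) (toℕ-fromℕ (s D)) (≤last (∈X⇒InBag (fromℕ (s D)) v∈Xs))

module Intervals {n} (H : SGraph n) (lo hi : Fin n → ℕ) where

  Alive : Fin n → ℕ → Set
  Alive v c = lo v ≤ c × c ≤ hi v

  alive? : ∀ v c → Dec (Alive v c)
  alive? v c = (lo v ≤? c) ×-dec (c ≤? hi v)

  bag : ℕ → Subset n
  bag c = tabulate λ v → does (alive? v c)

  ∈bag⁺ : ∀ {v c} → Alive v c → v ∈ bag c
  ∈bag⁺ {v} {c} alive = lookup⇒[]= v (bag c) (trans (lookup∘tabulate _ v) (does-yes (alive? v c)))
    where
    does-yes : (d : Dec (Alive v c)) → does d ≡ true
    does-yes (yes _)    = refl
    does-yes (no ¬alive) = contradiction alive ¬alive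

  ∈bag⁻ : ∀ {v c} → v ∈ bag c → Alive v c
  ∈bag⁻ {v} {c} v∈c = from-does (alive? v c) (trans (sym (lookup∘tabulate _ v)) ([]=⇒lookup v∈c))
    where
    from-does : (d : Dec (Alive v c)) → does d ≡ true → Alive v c
    from-does (yes alive) _ = alive

  module _ (S : ℕ)
           (alive⇒∈V : ∀ {v c} → Alive v c → v ∈ V H)
           (covered  : ∀ v → v ∈ V H → ∃ λ c → c ≤ S × Alive v c)
           (edges-meet : ∀ u v → E H u v ≡ true → ∃ λ c → c ≤ S × Alive u c × Alive v c)
           where

    private
      position : ∀ {c} → c ≤ S → Fin (suc S)
      position c≤S = fromℕ< (s≤s c≤S)

      ∈position : ∀ {v c} (c≤S : c ≤ S) → Alive v c → v ∈ bag (toℕ (position c≤S))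
      ∈position {v} c≤S alive = subst (λ c → v ∈ bag c) (sym (toℕ-fromℕ< (s≤s c≤S))) (∈bag⁺ alive)

    decomposition : PathDecomposition H
    decomposition = record
      { s        = S
      ; X        = λ i → bag (toℕ i)
      ; bags-V   = λ _ v∈c → alive⇒∈V (∈bag⁻ v∈c)
      ; covers   = λ v v∈H → let (c , c≤S , alive) = covered v v∈H in position c≤S , ∈position c≤S alive
      ; interval = λ v i j k i≤j j≤k v∈i v∈k →
                     ∈bag⁺ (≤-trans (proj₁ (∈bag⁻ v∈i)) i≤j , ≤-trans j≤k (proj₂ (∈bag⁻ v∈k)))
      ; edges    = λ u v e → let (c , c≤S , u-alive , v-alive) = edges-meet u v e in
                     position c≤S , ∈position c≤S u-alive , ∈position c≤S v-alive
      }

module Gluing {n} (G B : SGraph n) (k : ℕ) (Gs : Fin (suc k) → SGraph n) (xs : Fin (suc k) → Fin n)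
  (B≤G : B ≤G G) (Gs≤G : ∀ i → Gs i ≤G G)
  (coverV : ∀ v → v ∈ V G → (v ∈ V B) ⊎ (∃ λ i → v ∈ V (Gs i)))
  (coverE : ∀ u v → E G u v ≡ true → (E B u v ≡ true) ⊎ (∃ λ i → E (Gs i) u v ≡ true))
  (disjoint : ∀ i j v → i ≢ j → v ∈ V (Gs i) → v ∉ V (Gs j))
  (xs∈ : ∀ i → (xs i ∈ V B) × (xs i ∈ V (Gs i)))
  (meet : ∀ i v → v ∈ V B → v ∈ V (Gs i) → v ≡ xs i)
  (x : Fin n) (x∈B : x ∈ V B)
  (DB : PathDecomposition B) (xs₀∈DB : xs zero ∈ X DB zero)
  (D : ∀ i → PathDecomposition (Gs i)) (xs∈D : ∀ i → xs i ∈ X (D i) zero)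
  where

  same-index : ∀ {v i j} → v ∈ V (Gs i) → v ∈ V (Gs j) → i ≡ j
  same-index {v} {i} {j} v∈Gi v∈Gj with i ≟ᶠ j
  ... | yes i≡j = i≡j
  ... | no  i≢j = contradiction v∈Gj (disjoint i j v i≢j v∈Gi)

  B̂ : PathDecomposition B
  B̂ = reverse (addToBags x x∈B DB)

  module OB = Occurrences B̂
  module OD (i : Fin (suc k)) = Occurrences (D i)
  open OB using () renaming (bagAt to Y; InBag to InY; first to fB; last to lB)
  open OD using () renaming (bagAt to Z; InBag to InZ; first to fZ; last to lZ)

  t : ℕ
  t = s B̂

  sZ : Fin (suc k) → ℕ
  sZ i = s (D i)

  fB-x : fB x ≡ 0
  fB-x = OB.first≡0 (addToBags-∈ x∈B DB _)

  t≤lB-xs₀ : t ≤ lB (xs zero)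
  t≤lB-xs₀ = OB.s≤last (reverse-∈last (addToBags x x∈B DB) (addToBags-⊇ x∈B DB zero xs₀∈DB))

  fZ-xs : ∀ i → fZ i (xs i) ≡ 0
  fZ-xs i = OD.first≡0 i (xs∈D i)

  -- Positions are split into blocks of length M, each split into slots of length W. Bag q of B̂
  -- sits at the start of block q; D (suc i) fills slot suc i of block lB (xs (suc i)), right
  -- after the last bag of B̂ containing xs (suc i); D zero fills slot zero of block suc t.
  W M : ℕ
  W = suc (maxᶠ (suc k) sZ)
  M = suc k * W

  sZ<W : ∀ i → sZ i < W
  sZ<W i = s≤s (≤maxᶠ (suc k) sZ i)

  slotBlock : Fin (suc k) → ℕ
  slotBlock zero    = suc t
  slotBlock (suc i) = lB (xs (suc i))

  base : Fin (suc k) → ℕ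
  base i = toℕ i * W + slotBlock i * M

  S : ℕ
  S = base zero + sZ zero

  record InSlot (i : Fin (suc k)) (c : ℕ) : Set where
    constructor slot
    field
      base≤ : base i ≤ c
      ≤end  : c ≤ base i + sZ i

  inSlot? : ∀ i c → Dec (InSlot i c)
  inSlot? i c = map′ (λ (b≤ , ≤e) → slot b≤ ≤e) (λ (slot b≤ ≤e) → b≤ , ≤e)
                     ((base i ≤? c) ×-dec (c ≤? base i + sZ i))

  slot-position : ∀ {i c} → InSlot i c →
                  c ∸ base i + toℕ i * W < M × c ≡ (c ∸ base i + toℕ i * W) + slotBlock i * M
  slot-position {i} {c} (slot base≤c c≤) = offset<M , position
    where
    r = c ∸ base i
    offset<M : r + toℕ i * W < M
    offset<M = begin-strict
      r + toℕ i * W    <⟨ +-monoˡ-< (toℕ i * W) (≤-<-trans (m≤n+o⇒m∸n≤o c (base i) c≤) (sZ<W i)) ⟩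
      suc (toℕ i) * W  ≤⟨ *-monoˡ-≤ W (toℕ<n i) ⟩
      M                ∎
      where open ≤-Reasoning
    position : c ≡ (r + toℕ i * W) + slotBlock i * M
    position = trans (sym (m∸n+n≡m base≤c)) (sym (+-assoc r (toℕ i * W) (slotBlock i * M)))

  slot-block : ∀ {i c} → InSlot i c → Block M (slotBlock i) c
  slot-block {i} {c} sl = let (offset<M , position) = slot-position sl in
    subst (Block M (slotBlock i)) (sym position) (Block-+ offset<M)

  slot-offset-block : ∀ {i c} → InSlot i c → Block W (toℕ i) (c ∸ slotBlock i * M)
  slot-offset-block {i} {c} sl = let (_ , position) = slot-position sl in
    subst (Block W (toℕ i)) (sym (trans (cong (_∸ slotBlock i * M) position) (m+n∸n≡m _ (slotBlock i * M))))
      (Block-+ (≤-<-trans (m≤n+o⇒m∸n≤o c (base i) (InSlot.≤end sl)) (sZ<W i)))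

  slot-unique : ∀ {i i′ c} → InSlot i c → InSlot i′ c → i ≡ i′
  slot-unique {i} {i′} {c} sl sl′ = toℕ-injective (Block-unique (slot-offset-block sl) offset-block′)
    where
    offset-block′ : Block W (toℕ i′) (c ∸ slotBlock i * M)
    offset-block′ = subst (λ a → Block W (toℕ i′) (c ∸ a * M)) (sym (Block-unique (slot-block sl) (slot-block sl′)))
                      (slot-offset-block sl′)

  slotBlock≤t : ∀ i → slotBlock (suc i) ≤ t
  slotBlock≤t i = OB.last≤s (xs (suc i))

  lB*M≤base : ∀ i → lB (xs i) * M ≤ base i
  lB*M≤base zero    = *-monoˡ-≤ M (m≤n⇒m≤1+n (OB.last≤s (xs zero)))
  lB*M≤base (suc i) = m≤n+m (slotBlock (suc i) * M) (toℕ (suc i) * W)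

  InSlot-base : ∀ {i q} → q ≤ sZ i → InSlot i (base i + q)
  InSlot-base {i} q≤ = slot (m≤m+n (base i) _) (+-monoʳ-≤ (base i) q≤)

  slot<base₀ : ∀ {i c} → InSlot (suc i) c → c < base zero
  slot<base₀ {i} sl = <-≤-trans (Block.upper (slot-block sl)) (*-monoˡ-≤ M (s≤s (slotBlock≤t i)))

  InSlot⇒≤S : ∀ {i c} → InSlot i c → c ≤ S
  InSlot⇒≤S {zero}  (slot _ c≤S) = c≤S
  InSlot⇒≤S {suc i} sl        = ≤-trans (<⇒≤ (slot<base₀ sl)) (m≤m+n (base zero) (sZ zero))

  B-position<base₀ : ∀ {q} → q ≤ t → q * M < base zero
  B-position<base₀ q≤t = ≤-<-trans (*-monoˡ-≤ M q≤t) (m<n+m (t * M) z<s)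

  B-position≤S : ∀ {q} → q ≤ t → q * M ≤ S
  B-position≤S q≤t = ≤-trans (<⇒≤ (B-position<base₀ q≤t)) (m≤m+n (base zero) (sZ zero))

  data Place : Fin n → Set where
    onlyB   : ∀ {v} → v ∈ V B → (∀ i → v ∉ V (Gs i)) → Place v
    joint   : ∀ i → Place (xs i)
    onlyG   : ∀ {v} → v ∉ V B → ∀ i → v ∈ V (Gs i) → Place v
    outside : ∀ {v} → v ∉ V B → (∀ i → v ∉ V (Gs i)) → Place v

  place : ∀ v → Place v
  place v with v ∈? V B | any? (λ i → v ∈? V (Gs i))
  ... | yes v∈B | yes (i , v∈Gi) = subst Place (sym (meet i v v∈B v∈Gi)) (joint i)
  ... | yes v∈B | no  v∉G        = onlyB v∈B (λ i v∈Gi → v∉G (i , v∈Gi))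
  ... | no  v∉B | yes (i , v∈Gi) = onlyG v∉B i v∈Gi
  ... | no  v∉B | no  v∉G        = outside v∉B (λ i v∈Gi → v∉G (i , v∈Gi))

  lo hi : ∀ {v} → Place v → ℕ
  lo {v} (onlyB _ _)   = fB v * M
  lo     (joint i)     = fB (xs i) * M
  lo {v} (onlyG _ i _) = base i + fZ i v
  lo     (outside _ _) = 1
  hi {v} (onlyB _ _)   = lB v * M
  hi     (joint i)     = base i + lZ i (xs i)
  hi {v} (onlyG _ i _) = base i + lZ i v
  hi     (outside _ _) = 0

  AliveAt : ∀ {v} → Place v → ℕ → Set
  AliveAt π c = lo π ≤ c × c ≤ hi π

  open Intervals G (λ v → lo (place v)) (λ v → hi (place v)) using (Alive; bag; ∈bag⁺; ∈bag⁻; decomposition)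

  alive⇒∈G : ∀ {v c} (π : Place v) → AliveAt π c → v ∈ V G
  alive⇒∈G (onlyB v∈B _)      _            = proj₁ B≤G v∈B
  alive⇒∈G (joint i)          _            = proj₁ B≤G (proj₁ (xs∈ i))
  alive⇒∈G (onlyG _ i v∈Gi)   _            = proj₁ (Gs≤G i) v∈Gi
  alive⇒∈G (outside _ _)      (lo≤c , c≤hi) = contradiction (≤-trans lo≤c c≤hi) λ ()

  InY⇒alive : ∀ {v q} → InY v q → (π : Place v) → AliveAt π (q * M)
  InY⇒alive v∈q (onlyB _ _)     = *-monoˡ-≤ M (OB.first≤ v∈q) , *-monoˡ-≤ M (OB.≤last v∈q)
  InY⇒alive v∈q (joint i)       = *-monoˡ-≤ M (OB.first≤ v∈q) ,
                                  ≤-trans (*-monoˡ-≤ M (OB.≤last v∈q)) (≤-trans (lB*M≤base i) (m≤m+n (base i) _))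
  InY⇒alive v∈q (onlyG v∉B _ _) = contradiction (OB.InBag⇒∈V v∈q) v∉B
  InY⇒alive v∈q (outside v∉B _) = contradiction (OB.InBag⇒∈V v∈q) v∉B

  InZ⇒alive : ∀ {v} i {q} → InZ i v q → (π : Place v) → AliveAt π (base i + q)
  InZ⇒alive i v∈q (onlyB _ v∉G)   = contradiction (OD.InBag⇒∈V i v∈q) (v∉G i)
  InZ⇒alive i v∈q (joint j) with same-index (proj₂ (xs∈ j)) (OD.InBag⇒∈V i v∈q)
  ... | refl = ≤-trans (*-monoˡ-≤ M (OB.first≤last (proj₁ (xs∈ i)))) (≤-trans (lB*M≤base i) (m≤m+n (base i) _)) ,
               +-monoʳ-≤ (base i) (OD.≤last i v∈q)
  InZ⇒alive i v∈q (onlyG _ j v∈Gj) with same-index v∈Gj (OD.InBag⇒∈V i v∈q)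
  ... | refl = +-monoʳ-≤ (base i) (OD.first≤ i v∈q) , +-monoʳ-≤ (base i) (OD.≤last i v∈q)
  InZ⇒alive i v∈q (outside _ v∉G) = contradiction (OD.InBag⇒∈V i v∈q) (v∉G i)

  lo-B : ∀ {v} → v ∈ V B → (π : Place v) → lo π ≡ fB v * M
  lo-B _   (onlyB _ _)     = refl
  lo-B _   (joint _)       = refl
  lo-B v∈B (onlyG v∉B _ _) = contradiction v∈B v∉B
  lo-B v∈B (outside v∉B _) = contradiction v∈B v∉B

  G-span⇒InSlot : ∀ {v c} i → base i + fZ i v ≤ c × c ≤ base i + lZ i v → InSlot i c
  G-span⇒InSlot {v} i (lo≤c , c≤hi) =
    slot (≤-trans (m≤m+n (base i) _) lo≤c) (≤-trans c≤hi (+-monoʳ-≤ (base i) (OD.last≤s i v)))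

  hi-B : ∀ {v c} → v ∈ V B → (π : Place v) → AliveAt π c → c < base zero → c < suc (lB v) * M
  hi-B {v} _ (onlyB _ _) (_ , c≤hi) _ = ≤-<-trans c≤hi (m<n+m (lB v * M) z<s)
  hi-B _ (joint zero)    _ c<base₀ = <-≤-trans c<base₀ (*-monoˡ-≤ M (s≤s t≤lB-xs₀))
  hi-B _ (joint (suc i)) (_ , c≤hi) _ =
    ≤-<-trans c≤hi (Block.upper (slot-block (InSlot-base {suc i} (OD.last≤s (suc i) (xs (suc i))))))
  hi-B v∈B (onlyG v∉B _ _) _ _ = contradiction v∈B v∉B
  hi-B v∈B (outside v∉B _) _ _ = contradiction v∈B v∉B

  alive⇒InY : ∀ {v c j} → v ∈ V B → (π : Place v) → AliveAt π c → Block M j c → j ≤ t → InY v j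
  alive⇒InY v∈B π alive@(lo≤c , _) blk j≤t = OB.between⇒InBag v∈B
    (Block-lower (subst (_≤ _) (lo-B v∈B π) lo≤c) blk)
    (Block-upper (hi-B v∈B π alive (<-≤-trans (Block.upper blk) (*-monoˡ-≤ M (s≤s j≤t)))) blk)

  alive⇒InZ : ∀ {v i c} → v ∈ V (Gs i) → (π : Place v) → AliveAt π c → InZ i v (c ∸ base i)
  alive⇒InZ v∈Gi (onlyB _ v∉G) _ = contradiction v∈Gi (v∉G _)
  alive⇒InZ {i = i} {c} v∈Gi (joint j) (_ , c≤hi) with same-index (proj₂ (xs∈ j)) v∈Gi
  ... | refl = OD.between⇒InBag i v∈Gi (subst (_≤ c ∸ base i) (sym (fZ-xs i)) z≤n) (m≤n+o⇒m∸n≤o c (base i) c≤hi)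
  alive⇒InZ {v} {i} {c} v∈Gi (onlyG _ j v∈Gj) (lo≤c , c≤hi) with same-index v∈Gj v∈Gi
  ... | refl = OD.between⇒InBag i v∈Gi (m+n≤o⇒m≤o∸n (fZ i v) (subst (_≤ c) (+-comm (base i) (fZ i v)) lo≤c))
                 (m≤n+o⇒m∸n≤o c (base i) c≤hi)
  alive⇒InZ v∈Gi (outside _ v∉G) _ = contradiction v∈Gi (v∉G _)

  alive∉B⇒InSlot : ∀ {v c} → v ∉ V B → (π : Place v) → AliveAt π c → ∃ λ i → v ∈ V (Gs i) × InSlot i c
  alive∉B⇒InSlot v∉B (onlyB v∈B _)    _     = contradiction v∈B v∉B
  alive∉B⇒InSlot v∉B (joint i)        _     = contradiction (proj₁ (xs∈ i)) v∉B
  alive∉B⇒InSlot _   (onlyG _ i v∈Gi) alive = i , v∈Gi , G-span⇒InSlot i alive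
  alive∉B⇒InSlot _   (outside _ _)    (lo≤c , c≤hi) = contradiction (≤-trans lo≤c c≤hi) λ ()

  alive∉G₀⇒<base₀ : ∀ {v c} → v ∉ V (Gs zero) → (π : Place v) → AliveAt π c → c < base zero
  alive∉G₀⇒<base₀ {v} _ (onlyB _ _) (_ , c≤hi) = ≤-<-trans c≤hi (B-position<base₀ (OB.last≤s v))
  alive∉G₀⇒<base₀ v∉G₀ (joint zero) _ = contradiction (proj₂ (xs∈ zero)) v∉G₀
  alive∉G₀⇒<base₀ _ (joint (suc i)) (_ , c≤hi) =
    ≤-<-trans c≤hi (slot<base₀ (InSlot-base {suc i} (OD.last≤s (suc i) (xs (suc i)))))
  alive∉G₀⇒<base₀ v∉G₀ (onlyG _ zero v∈G₀) _ = contradiction v∈G₀ v∉G₀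
  alive∉G₀⇒<base₀ _ (onlyG _ (suc i) v∈Gi) alive = slot<base₀ (G-span⇒InSlot (suc i) alive)
  alive∉G₀⇒<base₀ _ (outside _ _) (lo≤c , c≤hi) = contradiction (≤-trans lo≤c c≤hi) λ ()

  alive⇒∈G₀ : ∀ {v c} → base zero ≤ c → (π : Place v) → AliveAt π c → v ∈ V (Gs zero)
  alive⇒∈G₀ {v} base₀≤c π alive with v ∈? V (Gs zero)
  ... | yes v∈G₀ = v∈G₀
  ... | no  v∉G₀ = contradiction base₀≤c (<⇒≱ (alive∉G₀⇒<base₀ v∉G₀ π alive))

  bag⊆Z₀ : ∀ {c} → InSlot zero c → bag c ⊆ Z zero (c ∸ base zero)
  bag⊆Z₀ sl {v} v∈c = let alive = ∈bag⁻ v∈c in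
    OD.∈bagAt (alive⇒InZ (alive⇒∈G₀ (InSlot.base≤ sl) (place v) alive) (place v) alive)

  bag⊆Y∪Z : ∀ {i c} → InSlot (suc i) c → bag c ⊆ (Y (lB (xs (suc i))) - xs (suc i)) ∪ Z (suc i) (c ∸ base (suc i))
  bag⊆Y∪Z {i} {c} sl {v} v∈c = ∈Y∪Z (v ∈? V B) (∈bag⁻ v∈c)
    where
    ∈Y∪Z : ∀ {v} → Dec (v ∈ V B) → AliveAt (place v) c →
             v ∈ (Y (lB (xs (suc i))) - xs (suc i)) ∪ Z (suc i) (c ∸ base (suc i))
    ∈Y∪Z {v} (yes v∈B) alive with v ≟ᶠ xs (suc i)
    ... | yes refl = x∈p∪q⁺ (inj₂ (OD.∈bagAt (alive⇒InZ (proj₂ (xs∈ (suc i))) (place v) alive)))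
    ... | no  v≢xs =
      x∈p∪q⁺ (inj₁ (x∈p∧x≢y⇒x∈p-y (OB.∈bagAt (alive⇒InY v∈B (place v) alive (slot-block sl) (slotBlock≤t i))) v≢xs))
    ∈Y∪Z {v} (no v∉B) alive with alive∉B⇒InSlot v∉B (place v) alive
    ... | j , v∈Gj , sl′ with slot-unique sl′ sl
    ...   | refl = x∈p∪q⁺ (inj₂ (OD.∈bagAt (alive⇒InZ v∈Gj (place v) alive)))

  bag⊆Y : ∀ {c} → c ≤ S → ¬ (∃ λ i → InSlot i c) → bag c ⊆ Y (c / M)
  bag⊆Y {c} c≤S no-slot {v} v∈c with v ∈? V B
  ... | yes v∈B = OB.∈bagAt (alive⇒InY v∈B (place v) (∈bag⁻ v∈c) (blockOf M c) (Block-upper c<base₀ (blockOf M c)))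
    where
    c<base₀ : c < base zero
    c<base₀ = ≰⇒> λ base₀≤c → no-slot (zero , slot base₀≤c c≤S)
  ... | no v∉B = contradiction (let (i , _ , sl) = alive∉B⇒InSlot v∉B (place v) (∈bag⁻ v∈c) in i , sl) no-slot

  G-decomposition : PathDecomposition G
  G-decomposition = decomposition S (λ {v} → alive⇒∈G (place v)) covered edges-meet
    where
    covered : ∀ v → v ∈ V G → ∃ λ c → c ≤ S × Alive v c
    covered v v∈G with coverV v v∈G
    ... | inj₁ v∈B = let (q , v∈q) = OB.occurs v∈B in
      q * M , B-position≤S (OB.InBag⇒≤s v∈q) , InY⇒alive v∈q (place v)
    ... | inj₂ (i , v∈Gi) = let (q , v∈q) = OD.occurs i v∈Gi in
      base i + q , InSlot⇒≤S (InSlot-base (OD.InBag⇒≤s i v∈q)) , InZ⇒alive i v∈q (place v)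

    edges-meet : ∀ u v → E G u v ≡ true → ∃ λ c → c ≤ S × Alive u c × Alive v c
    edges-meet u v e with coverE u v e
    ... | inj₁ e∈B = let (q , u∈q , v∈q) = edges B̂ u v e∈B in
      toℕ q * M , B-position≤S (s≤s⁻¹ (toℕ<n q)) ,
      InY⇒alive (OB.∈X⇒InBag q u∈q) (place u) , InY⇒alive (OB.∈X⇒InBag q v∈q) (place v)
    ... | inj₂ (i , e∈Gi) = let (q , u∈q , v∈q) = edges (D i) u v e∈Gi in
      base i + toℕ q , InSlot⇒≤S (InSlot-base (s≤s⁻¹ (toℕ<n q))) ,
      InZ⇒alive i (OD.∈X⇒InBag i q u∈q) (place u) , InZ⇒alive i (OD.∈X⇒InBag i q v∈q) (place v)

  x∈first-bag : x ∈ X G-decomposition zero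
  x∈first-bag = ∈bag⁺ (≤-reflexive (trans (lo-B x∈B (place x)) (cong (_* M) fB-x)) , z≤n)

  module _ {a b p} (widthB : WidthAtMost DB a) (width₀ : WidthAtMost (D zero) b)
           (widthD : ∀ i → WidthAtMost (D (suc i)) p) where

    ∣Y∣≤ : ∀ j → ∣ Y j ∣ ≤ suc (suc a)
    ∣Y∣≤ = OB.∣bagAt∣≤ (reverse-width (addToBags x x∈B DB) (addToBags-width x∈B DB widthB))

    ∣bag∣≤-G₀ : ∀ {c} → InSlot zero c → ∣ bag c ∣ ≤ suc b
    ∣bag∣≤-G₀ {c} sl = ≤-trans (p⊆q⇒∣p∣≤∣q∣ (bag⊆Z₀ sl)) (OD.∣bagAt∣≤ zero width₀ (c ∸ base zero))

    ∣bag∣≤-slot : ∀ {j c} → InSlot (suc j) c → ∣ bag c ∣ ≤ suc (a + p + 1)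
    ∣bag∣≤-slot {j} {c} sl = begin
      ∣ bag c ∣                     ≤⟨ p⊆q⇒∣p∣≤∣q∣ (bag⊆Y∪Z sl) ⟩
      ∣ (Yj - xs (suc j)) ∪ Zj ∣    ≤⟨ ∣p∪q∣≤∣p∣+∣q∣ (Yj - xs (suc j)) Zj ⟩
      ∣ Yj - xs (suc j) ∣ + ∣ Zj ∣  ≤⟨ +-mono-≤ (s≤s⁻¹ (≤-trans (x∈p⇒∣p-x∣<∣p∣ xs∈Yj) (∣Y∣≤ (lB (xs (suc j))))))
                                                 (OD.∣bagAt∣≤ (suc j) (widthD j) (c ∸ base (suc j))) ⟩
      suc a + suc p                 ≡⟨ cong suc (trans (+-suc a p) (+-comm 1 (a + p))) ⟩
      suc (a + p + 1)               ∎
      where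
      open ≤-Reasoning
      Yj = Y (lB (xs (suc j)))
      Zj = Z (suc j) (c ∸ base (suc j))
      xs∈B = proj₁ (xs∈ (suc j))
      xs∈Yj : xs (suc j) ∈ Yj
      xs∈Yj = OB.∈bagAt (OB.between⇒InBag xs∈B (OB.first≤last xs∈B) ≤-refl)

    ∣bag∣≤-B : ∀ {c} → c ≤ S → ¬ (∃ λ i → InSlot i c) → ∣ bag c ∣ ≤ suc (suc a)
    ∣bag∣≤-B {c} c≤S no-slot = ≤-trans (p⊆q⇒∣p∣≤∣q∣ (bag⊆Y c≤S no-slot)) (∣Y∣≤ (c / M))

    G-decomposition-width : WidthAtMost G-decomposition ((a + p + 1) ⊔ b)
    G-decomposition-width i with any? (λ j → inSlot? j (toℕ i))
    ... | yes (zero , sl)  = ≤-trans (∣bag∣≤-G₀ sl) (s≤s (m≤n⊔m _ b))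
    ... | yes (suc j , sl) = ≤-trans (∣bag∣≤-slot sl) (s≤s (m≤m⊔n _ b))
    ... | no no-slot       = ≤-trans (∣bag∣≤-B (s≤s⁻¹ (toℕ<n i)) no-slot) (s≤s (≤-trans suc-a≤ (m≤m⊔n _ b)))
      where
      suc-a≤ : suc a ≤ a + p + 1
      suc-a≤ = subst (_≤ a + p + 1) (+-comm a 1) (+-monoˡ-≤ 1 (m≤m+n a p))

lemma3p3 : ∀ {n : ℕ} (G B : SGraph n) (k : ℕ) → 1 ≤ k →
    (Gs : Fin (suc k) → SGraph n) (xs : Fin (suc k) → Fin n) →
    B ≤G G → (∀ i → Gs i ≤G G) →
    (∀ v → v ∈ V G → (v ∈ V B) ⊎ (∃ λ i → v ∈ V (Gs i))) →
    (∀ u v → E G u v ≡ true → (E B u v ≡ true) ⊎ (∃ λ i → E (Gs i) u v ≡ true)) →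
    (∀ i j v → i ≢ j → v ∈ V (Gs i) → v ∉ V (Gs j)) →
    (∀ i → (xs i ∈ V B) × (xs i ∈ V (Gs i))) →
    (∀ i v → v ∈ V B → v ∈ V (Gs i) → v ≡ xs i) →
    (p : ℕ) → (∀ i → i ≢ zero → PwAtMost (Gs i) (xs i) p) →
    ∀ x → x ∈ V B → (a b : ℕ) →
    PwAtMost B (xs zero) a → PwAtMost (Gs zero) (xs zero) b →
    PwAtMost G x ((a + p + 1) ⊔ b)
lemma3p3 G B k _ Gs xs B≤G Gs≤G coverV coverE disjoint xs∈ meet p pw-Gs x x∈B a b
         (DB , xs₀∈DB , widthB) (D₀ , xs₀∈D₀ , width₀) =
  G-decomposition , x∈first-bag , G-decomposition-width widthB width₀ (λ i → proj₂ (proj₂ (pw-Gs (suc i) λ ())))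
  where
  D : ∀ i → PathDecomposition (Gs i)
  D zero    = D₀
  D (suc i) = proj₁ (pw-Gs (suc i) λ ())

  xs∈D : ∀ i → xs i ∈ X (D i) zero
  xs∈D zero    = xs₀∈D₀
  xs∈D (suc i) = proj₁ (proj₂ (pw-Gs (suc i) λ ()))

  open Gluing G B k Gs xs B≤G Gs≤G coverV coverE disjoint xs∈ meet x x∈B DB xs₀∈DB D xs∈D
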